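{- Let $n\ge2$ and let $a,b,t$ be the unique integers with $n=af_t+bf_{t-1}$, $t\ge2$, $1\le a\le b\le f_t$. If $t$ is even then $\phi^{ -t}(\phi b-a)=\delta_n$, and if $t$ is odd then $\phi^{ -t}(\phi b-a)=\Delta_n$.
   Context: $f_k$ are the Fibonacci numbers, $f_1=f_2=1$, $f_{k+2}=f_{k+1}+f_k$; $\phi=(1+\sqrt5)/2$. (For every $n\ge2$ such integers $a,b,t$ exist and are unique.) $\delta_n=\phi n-\lfloor\phi n\rfloor$ and $\Delta_n=\lceil\phi n\rceil-\phi n$. -}

module Defs where

open import Data.Nat as ℕ using (ℕ; zero; suc)
open import Data.Integer as ℤ using (ℤ; +_; 0ℤ; 1ℤ; -_)
open import Data.Product using (_×_)
open import Data.Sum using (_⊎_)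
open import Relation.Nullary using (¬_)

fib : ℕ → ℕ
fib zero = zero
fib (suc zero) = suc zero
fib (suc (suc k)) = fib (suc k) ℕ.+ fib k

-- Elements of the ring ℤ[φ] ⊂ ℝ, φ = (1+√5)/2: the pair (re , im) denotes re + im·φ.
-- Since φ is irrational, this representation is unique, so ≡ on pairs is real equality.
record ℤφ : Set where
  constructor _+_φ
  field
    re : ℤ
    im : ℤ
open ℤφ public

infixl 6 _⊕_ _⊖_
infixl 7 _⊗_

_⊕_ : ℤφ → ℤφ → ℤφ
(x + y φ) ⊕ (u + v φ) = (x ℤ.+ u) + (y ℤ.+ v) φ

neg : ℤφ → ℤφ
neg (x + y φ) = (ℤ.- x) + (ℤ.- y) φ

_⊖_ : ℤφ → ℤφ → ℤφ
p ⊖ q = p ⊕ neg q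

-- (x + yφ)(u + vφ) = (xu + yv) + (xv + yu + yv)φ, using φ² = φ + 1.
_⊗_ : ℤφ → ℤφ → ℤφ
(x + y φ) ⊗ (u + v φ) = (x ℤ.* u ℤ.+ y ℤ.* v) + (x ℤ.* v ℤ.+ y ℤ.* u ℤ.+ y ℤ.* v) φ

ι : ℤ → ℤφ
ι x = x + 0ℤ φ

ιₙ : ℕ → ℤφ
ιₙ n = ι (+ n)

φ : ℤφ
φ = 0ℤ + 1ℤ φ

φ⁻¹ : ℤφ
φ⁻¹ = (ℤ.- 1ℤ) + 1ℤ φ

φ^-_ : ℕ → ℤφ
φ^- zero = ι 1ℤ
φ^- suc t = φ⁻¹ ⊗ (φ^- t)

-- Real order on ℤ[φ].  x + yφ = (p + q√5)/2 with p = 2x + y, q = y,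
-- and p + q√5 ≥ 0 is decided by the usual case analysis.
NonNeg√5 : ℤ → ℤ → Set
NonNeg√5 p q =
  (0ℤ ℤ.≤ p × 0ℤ ℤ.≤ q)
  ⊎ (0ℤ ℤ.≤ p × q ℤ.< 0ℤ × (+ 5) ℤ.* (q ℤ.* q) ℤ.≤ p ℤ.* p)
  ⊎ (p ℤ.< 0ℤ × 0ℤ ℤ.< q × p ℤ.* p ℤ.≤ (+ 5) ℤ.* (q ℤ.* q))

NonNeg : ℤφ → Set
NonNeg (x + y φ) = NonNeg√5 (+ 2 ℤ.* x ℤ.+ y) y

_≤φ_ : ℤφ → ℤφ → Set
p ≤φ q = NonNeg (q ⊖ p)

_<φ_ : ℤφ → ℤφ → Set
p <φ q = ¬ (q ≤φ p)

IsFloor : ℤ → ℤφ → Set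
IsFloor k x = (ι k ≤φ x) × (x <φ ι (k ℤ.+ 1ℤ))

IsCeil : ℤ → ℤφ → Set
IsCeil k x = (ι (k ℤ.- 1ℤ) <φ x) × (x ≤φ ι k)

module Submission where

-- Write N(x + yφ) = x² + xy − y² and Tr(x + yφ) = 2x + y for the norm and trace of ℤ[φ].  The
-- norm is multiplicative with N(φ⁻¹) = −1, and φ^(−t) = ±(f_{t+1} − f_t φ) according to the parity
-- of t, so w = φ^(−t)(φb − a) equals ±(φn − m) with m = a f_{t+1} + b f_t, and N(w) = ±(a² − ab − b²).
-- Since Tr(d)² − 5 im(d)² = 4 N(d), norm and trace decide where d lies: for im d > 0,
-- Tr d ≤ N d ≤ 0 gives 0 ≤ d < 1, and for im d < 0 so does 0 ≤ N d < Tr d − 1.  With 1 ≤ a ≤ b ≤ f_t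
-- both conditions reduce to a² ≤ ab + b² and ab + b² + n < 2m.  Hence m = ⌊φn⌋ for even t and
-- m = ⌈φn⌉ for odd t, and floors and ceilings in ℤ[φ] are unique.

open import Defs
open import Data.Nat using (ℕ; _≤_; _*_; _+_; _∸_; _%_)
open import Data.Integer using (ℤ)
open import Data.Product using (_×_)
open import Relation.Binary.PropositionalEquality using (_≡_)

open import Data.Nat as ℕ using (zero; suc; _<_)
open import Data.Integer as ℤ using (+_; 0ℤ; 1ℤ; -1ℤ; -_; +≤+; +<+; -<+)
import Data.Integer.Properties as ℤ
open import Data.Integer.Tactic.RingSolver using (solve-∀)
import Data.Nat.Tactic.RingSolver as NS
open import Data.Product using (_,_)
open import Data.Sum using (inj₁; inj₂)
open import Relation.Binary.PropositionalEquality using (refl; sym; trans; cong; cong₂; subst; subst₂; module ≡-Reasoning)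
open import Relation.Nullary using (¬_; yes; no; contradiction)
open import Function using (_∘_)
import Data.Nat.Properties as ℕ
open import Data.Nat.DivMod using (_/_; m≡m%n+[m/n]*n)

norm : ℤφ → ℤ
norm (x + y φ) = x ℤ.* x ℤ.+ x ℤ.* y ℤ.- y ℤ.* y

-- NonNeg z unfolds to NonNeg√5 (trace z) (im z).
trace : ℤφ → ℤ
trace (x + y φ) = + 2 ℤ.* x ℤ.+ y

norm-⊗ : ∀ u v → norm (u ⊗ v) ≡ norm u ℤ.* norm v
norm-⊗ (x + y φ) (u + v φ) = identity x y u v
  where
  identity : ∀ x y u v →
    let p = x ℤ.* u ℤ.+ y ℤ.* v ; q = x ℤ.* v ℤ.+ y ℤ.* u ℤ.+ y ℤ.* v in
    p ℤ.* p ℤ.+ p ℤ.* q ℤ.- q ℤ.* q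
      ≡ (x ℤ.* x ℤ.+ x ℤ.* y ℤ.- y ℤ.* y) ℤ.* (u ℤ.* u ℤ.+ u ℤ.* v ℤ.- v ℤ.* v)
  identity = solve-∀

4norm≡trace²-5im² : ∀ z → + 4 ℤ.* norm z ≡ trace z ℤ.* trace z ℤ.- + 5 ℤ.* (im z ℤ.* im z)
4norm≡trace²-5im² (x + y φ) = identity x y
  where
  identity : ∀ x y → + 4 ℤ.* (x ℤ.* x ℤ.+ x ℤ.* y ℤ.- y ℤ.* y)
                     ≡ (+ 2 ℤ.* x ℤ.+ y) ℤ.* (+ 2 ℤ.* x ℤ.+ y) ℤ.- + 5 ℤ.* (y ℤ.* y)
  identity = solve-∀

module _ (z : ℤφ) where

  norm≤0⇒trace²≤5im² : norm z ℤ.≤ 0ℤ → trace z ℤ.* trace z ℤ.≤ + 5 ℤ.* (im z ℤ.* im z)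
  norm≤0⇒trace²≤5im² N≤0 =
    ℤ.i-j≤0⇒i≤j (subst (ℤ._≤ 0ℤ) (4norm≡trace²-5im² z) (ℤ.*-monoˡ-≤-nonNeg (+ 4) N≤0))

  trace²≤5im²⇒norm≤0 : trace z ℤ.* trace z ℤ.≤ + 5 ℤ.* (im z ℤ.* im z) → norm z ℤ.≤ 0ℤ
  trace²≤5im²⇒norm≤0 p²≤5q² =
    ℤ.*-cancelˡ-≤-pos (norm z) 0ℤ (+ 4) (subst (ℤ._≤ 0ℤ) (sym (4norm≡trace²-5im² z)) (ℤ.i≤j⇒i-j≤0 p²≤5q²))

  0≤norm⇒5im²≤trace² : 0ℤ ℤ.≤ norm z → + 5 ℤ.* (im z ℤ.* im z) ℤ.≤ trace z ℤ.* trace z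
  0≤norm⇒5im²≤trace² 0≤N =
    ℤ.0≤i-j⇒j≤i (subst (0ℤ ℤ.≤_) (4norm≡trace²-5im² z) (ℤ.*-monoˡ-≤-nonNeg (+ 4) 0≤N))

  5im²≤trace²⇒0≤norm : + 5 ℤ.* (im z ℤ.* im z) ℤ.≤ trace z ℤ.* trace z → 0ℤ ℤ.≤ norm z
  5im²≤trace²⇒0≤norm 5q²≤p² =
    ℤ.*-cancelˡ-≤-pos 0ℤ (norm z) (+ 4) (subst (0ℤ ℤ.≤_) (sym (4norm≡trace²-5im² z)) (ℤ.i≤j⇒0≤j-i 5q²≤p²))

  norm≤0⇒NonNeg : 0ℤ ℤ.< im z → norm z ℤ.≤ 0ℤ → NonNeg z
  norm≤0⇒NonNeg 0<q N≤0 with 0ℤ ℤ.≤? trace z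
  ... | yes 0≤p = inj₁ (0≤p , ℤ.<⇒≤ 0<q)
  ... | no  p≱0 = inj₂ (inj₂ (ℤ.≰⇒> p≱0 , 0<q , norm≤0⇒trace²≤5im² N≤0))

  0<norm⇒¬NonNeg : 0ℤ ℤ.< im z → trace z ℤ.< 0ℤ → 0ℤ ℤ.< norm z → ¬ NonNeg z
  0<norm⇒¬NonNeg _   p<0 _   (inj₁ (0≤p , _))              = ℤ.<⇒≱ p<0 0≤p
  0<norm⇒¬NonNeg 0<q _   _   (inj₂ (inj₁ (_ , q<0 , _)))   = ℤ.<⇒≱ q<0 (ℤ.<⇒≤ 0<q)
  0<norm⇒¬NonNeg _   _   0<N (inj₂ (inj₂ (_ , _ , p²≤5q²))) = ℤ.<⇒≱ 0<N (trace²≤5im²⇒norm≤0 p²≤5q²)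

  0≤norm⇒NonNeg : 0ℤ ℤ.≤ trace z → 0ℤ ℤ.≤ norm z → NonNeg z
  0≤norm⇒NonNeg 0≤p 0≤N with 0ℤ ℤ.≤? im z
  ... | yes 0≤q = inj₁ (0≤p , 0≤q)
  ... | no  q≱0 = inj₂ (inj₁ (0≤p , ℤ.≰⇒> q≱0 , 0≤norm⇒5im²≤trace² 0≤N))

  norm<0⇒¬NonNeg : im z ℤ.< 0ℤ → norm z ℤ.< 0ℤ → ¬ NonNeg z
  norm<0⇒¬NonNeg q<0 _   (inj₁ (_ , 0≤q))              = ℤ.<⇒≱ q<0 0≤q
  norm<0⇒¬NonNeg _   N<0 (inj₂ (inj₁ (_ , _ , 5q²≤p²))) = ℤ.<⇒≱ N<0 (5im²≤trace²⇒0≤norm 5q²≤p²)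
  norm<0⇒¬NonNeg q<0 _   (inj₂ (inj₂ (_ , 0<q , _)))   = ℤ.<⇒≱ q<0 (ℤ.<⇒≤ 0<q)

InUnitInterval : ℤφ → Set
InUnitInterval d = NonNeg d × ¬ NonNeg (d ⊖ ι 1ℤ)

im-⊖ι : ∀ d k → im (d ⊖ ι k) ≡ im d
im-⊖ι d k = ℤ.+-identityʳ (im d)

trace-⊖1 : ∀ d → trace (d ⊖ ι 1ℤ) ≡ trace d ℤ.- + 2
trace-⊖1 (x + y φ) = identity x y
  where
  identity : ∀ x y → + 2 ℤ.* (x ℤ.+ - 1ℤ) ℤ.+ (y ℤ.+ 0ℤ) ≡ + 2 ℤ.* x ℤ.+ y ℤ.- + 2
  identity = solve-∀

norm-⊖1 : ∀ d → norm (d ⊖ ι 1ℤ) ≡ norm d ℤ.+ 1ℤ ℤ.- trace d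
norm-⊖1 (x + y φ) = identity x y
  where
  identity : ∀ x y → let x' = x ℤ.+ - 1ℤ ; y' = y ℤ.+ 0ℤ in
    x' ℤ.* x' ℤ.+ x' ℤ.* y' ℤ.- y' ℤ.* y'
      ≡ x ℤ.* x ℤ.+ x ℤ.* y ℤ.- y ℤ.* y ℤ.+ 1ℤ ℤ.- (+ 2 ℤ.* x ℤ.+ y)
  identity = solve-∀

i<j⇒i-j<0 : ∀ {i j} → i ℤ.< j → i ℤ.- j ℤ.< 0ℤ
i<j⇒i-j<0 {i} {j} i<j = subst (i ℤ.- j ℤ.<_) (ℤ.+-inverseʳ j) (ℤ.+-monoˡ-< (- j) i<j)

i<j⇒0<j-i : ∀ {i j} → i ℤ.< j → 0ℤ ℤ.< j ℤ.- i
i<j⇒0<j-i {i} {j} i<j = subst (ℤ._< j ℤ.- i) (ℤ.+-inverseʳ i) (ℤ.+-monoˡ-< (- i) i<j)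

i<i+1 : ∀ i → i ℤ.< i ℤ.+ 1ℤ
i<i+1 i = ℤ.suc[i]≤j⇒i<j (ℤ.≤-reflexive (ℤ.+-comm 1ℤ i))

0<im⇒InUnitInterval : ∀ d → 0ℤ ℤ.< im d → trace d ℤ.≤ norm d → norm d ℤ.≤ 0ℤ → InUnitInterval d
0<im⇒InUnitInterval d 0<q p≤N N≤0 =
  norm≤0⇒NonNeg d 0<q N≤0 ,
  0<norm⇒¬NonNeg (d ⊖ ι 1ℤ)
    (subst (0ℤ ℤ.<_) (sym (im-⊖ι d 1ℤ)) 0<q)
    (subst (ℤ._< 0ℤ) (sym (trace-⊖1 d)) (ℤ.≤-<-trans (ℤ.+-monoˡ-≤ (- + 2) (ℤ.≤-trans p≤N N≤0)) -<+))
    (subst (0ℤ ℤ.<_) (sym (norm-⊖1 d)) (i<j⇒0<j-i (ℤ.≤-<-trans p≤N (i<i+1 (norm d)))))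

im<0⇒InUnitInterval : ∀ d → im d ℤ.< 0ℤ → 0ℤ ℤ.≤ norm d → norm d ℤ.+ 1ℤ ℤ.< trace d → InUnitInterval d
im<0⇒InUnitInterval d q<0 0≤N N+1<p =
  0≤norm⇒NonNeg d (ℤ.<⇒≤ (ℤ.≤-<-trans 0≤N (ℤ.<-trans (i<i+1 (norm d)) N+1<p))) 0≤N ,
  norm<0⇒¬NonNeg (d ⊖ ι 1ℤ)
    (subst (ℤ._< 0ℤ) (sym (im-⊖ι d 1ℤ)) q<0)
    (subst (ℤ._< 0ℤ) (sym (norm-⊖1 d)) (i<j⇒i-j<0 N+1<p))

*-self-mono-≤ : ∀ {i j} → 0ℤ ℤ.≤ i → i ℤ.≤ j → i ℤ.* i ℤ.≤ j ℤ.* j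
*-self-mono-≤ {i} {j} 0≤i i≤j =
  ℤ.≤-trans (ℤ.*-monoʳ-≤-nonNeg i {{ℤ.nonNegative 0≤i}} i≤j)
            (ℤ.*-monoˡ-≤-nonNeg j {{ℤ.nonNegative (ℤ.≤-trans 0≤i i≤j)}} i≤j)

*-self-antimono-≤ : ∀ {i j} → i ℤ.≤ j → j ℤ.< 0ℤ → j ℤ.* j ℤ.≤ i ℤ.* i
*-self-antimono-≤ {i} {j} i≤j j<0 =
  subst₂ ℤ._≤_ (neg*neg j) (neg*neg i)
    (*-self-mono-≤ (ℤ.<⇒≤ (ℤ.neg-mono-< j<0)) (ℤ.neg-mono-≤ i≤j))
  where
  neg*neg : ∀ i → - i ℤ.* - i ≡ i ℤ.* i
  neg*neg = solve-∀

NonNeg√5-mono-≤ : ∀ {p p' q} → p ℤ.≤ p' → NonNeg√5 p q → NonNeg√5 p' q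
NonNeg√5-mono-≤ p≤p' (inj₁ (0≤p , 0≤q)) = inj₁ (ℤ.≤-trans 0≤p p≤p' , 0≤q)
NonNeg√5-mono-≤ p≤p' (inj₂ (inj₁ (0≤p , q<0 , 5q²≤p²))) =
  inj₂ (inj₁ (ℤ.≤-trans 0≤p p≤p' , q<0 , ℤ.≤-trans 5q²≤p² (*-self-mono-≤ 0≤p p≤p')))
NonNeg√5-mono-≤ {p' = p'} p≤p' (inj₂ (inj₂ (p<0 , 0<q , p²≤5q²))) with 0ℤ ℤ.≤? p'
... | yes 0≤p' = inj₁ (0≤p' , ℤ.<⇒≤ 0<q)
... | no  p'≱0 = inj₂ (inj₂ (ℤ.≰⇒> p'≱0 , 0<q , ℤ.≤-trans (*-self-antimono-≤ p≤p' (ℤ.≰⇒> p'≱0)) p²≤5q²))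

NonNeg-mono-re : ∀ {u v} → im u ≡ im v → re u ℤ.≤ re v → NonNeg u → NonNeg v
NonNeg-mono-re {_ + y φ} {_ + .y φ} refl x≤x' =
  NonNeg√5-mono-≤ (ℤ.+-monoˡ-≤ y (ℤ.*-monoˡ-≤-nonNeg (+ 2) x≤x'))

ι-≤φ-trans : ∀ {j k} y → j ℤ.≤ k → ι k ≤φ y → ι j ≤φ y
ι-≤φ-trans y j≤k = NonNeg-mono-re refl (ℤ.+-monoʳ-≤ (re y) (ℤ.neg-mono-≤ j≤k))

≤φ-ι-trans : ∀ {j k} y → j ℤ.≤ k → y ≤φ ι j → y ≤φ ι k
≤φ-ι-trans y j≤k = NonNeg-mono-re refl (ℤ.+-monoˡ-≤ (- re y) j≤k)

i<j⇒i+1≤j : ∀ {i j} → i ℤ.< j → i ℤ.+ 1ℤ ℤ.≤ j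
i<j⇒i+1≤j {i} i<j = subst (ℤ._≤ _) (ℤ.+-comm 1ℤ i) (ℤ.i<j⇒suc[i]≤j i<j)

IsFloor-≤ : ∀ {j k y} → IsFloor j y → IsFloor k y → j ℤ.≤ k
IsFloor-≤ {j} {k} {y} (j≤y , _) (_ , y<k+1) with j ℤ.≤? k
... | yes j≤k = j≤k
... | no  j≰k = contradiction (ι-≤φ-trans {k ℤ.+ 1ℤ} {j} y (i<j⇒i+1≤j (ℤ.≰⇒> j≰k)) j≤y) y<k+1

IsFloor-unique : ∀ {j k y} → IsFloor j y → IsFloor k y → j ≡ k
IsFloor-unique {y = y} fj fk = ℤ.≤-antisym (IsFloor-≤ {y = y} fj fk) (IsFloor-≤ {y = y} fk fj)

i<j⇒i≤j-1 : ∀ {i j} → i ℤ.< j → i ℤ.≤ j ℤ.- 1ℤ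
i<j⇒i≤j-1 {i} {j} i<j =
  subst (ℤ._≤ j ℤ.- 1ℤ) (identity i) (ℤ.+-monoˡ-≤ (- 1ℤ) (i<j⇒i+1≤j i<j))
  where
  identity : ∀ i → i ℤ.+ 1ℤ ℤ.- 1ℤ ≡ i
  identity = solve-∀

IsCeil-≤ : ∀ {j k y} → IsCeil j y → IsCeil k y → j ℤ.≤ k
IsCeil-≤ {j} {k} {y} (j-1<y , _) (_ , y≤k) with j ℤ.≤? k
... | yes j≤k = j≤k
... | no  j≰k = contradiction (≤φ-ι-trans {k} {j ℤ.- 1ℤ} y (i<j⇒i≤j-1 (ℤ.≰⇒> j≰k)) y≤k) j-1<y

IsCeil-unique : ∀ {j k y} → IsCeil j y → IsCeil k y → j ≡ k
IsCeil-unique {y = y} cj ck = ℤ.≤-antisym (IsCeil-≤ {y = y} cj ck) (IsCeil-≤ {y = y} ck cj)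

y⊖ι[k+j] : ∀ y k j → y ⊖ ι (k ℤ.+ j) ≡ (y ⊖ ι k) ⊖ ι j
y⊖ι[k+j] (x + q φ) k j = cong₂ _+_φ (identity x k j) (sym (ℤ.+-identityʳ (q ℤ.+ 0ℤ)))
  where
  identity : ∀ x k j → x ℤ.+ - (k ℤ.+ j) ≡ x ℤ.+ - k ℤ.+ - j
  identity = solve-∀

ι[k-j]⊖y : ∀ k j y → ι (k ℤ.- j) ⊖ y ≡ (ι k ⊖ y) ⊖ ι j
ι[k-j]⊖y k j (x + q φ) = cong₂ _+_φ (identity k j x) (sym (ℤ.+-identityʳ (0ℤ ℤ.+ - q)))
  where
  identity : ∀ k j x → k ℤ.- j ℤ.+ - x ≡ k ℤ.+ - x ℤ.+ - j
  identity = solve-∀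

InUnitInterval⇒IsFloor : ∀ {k y} → InUnitInterval (y ⊖ ι k) → IsFloor k y
InUnitInterval⇒IsFloor {k} {y} (0≤d , d<1) = 0≤d , d<1 ∘ subst NonNeg (y⊖ι[k+j] y k 1ℤ)

InUnitInterval⇒IsCeil : ∀ {k y} → InUnitInterval (ι k ⊖ y) → IsCeil k y
InUnitInterval⇒IsCeil {k} {y} (0≤d , d<1) = d<1 ∘ subst NonNeg (ι[k-j]⊖y k 1ℤ y) , 0≤d

φ⁻¹-⊗ : ∀ x y → φ⁻¹ ⊗ _+_φ x y ≡ _+_φ (y ℤ.- x) x
φ⁻¹-⊗ x y = cong₂ _+_φ (re-identity x y) (im-identity x y)
  where
  re-identity : ∀ x y → - 1ℤ ℤ.* x ℤ.+ 1ℤ ℤ.* y ≡ y ℤ.- x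
  re-identity = solve-∀
  im-identity : ∀ x y → - 1ℤ ℤ.* y ℤ.+ 1ℤ ℤ.* x ℤ.+ 1ℤ ℤ.* y ≡ x
  im-identity = solve-∀

φ^-even : ∀ s → φ^- (s * 2) ≡ _+_φ (+ fib (suc (s * 2))) (- + fib (s * 2))
φ^-odd  : ∀ s → φ^- (suc (s * 2)) ≡ _+_φ (- + fib (suc (suc (s * 2)))) (+ fib (suc (s * 2)))

φ^-even zero    = refl
φ^-even (suc s) = begin
  φ⁻¹ ⊗ φ^- (suc (s * 2))                ≡⟨ cong (φ⁻¹ ⊗_) (φ^-odd s) ⟩
  φ⁻¹ ⊗ _+_φ (- + F₂) (+ F₁)             ≡⟨ φ⁻¹-⊗ (- + F₂) (+ F₁) ⟩
  _+_φ (+ F₁ ℤ.- - + F₂) (- + F₂)        ≡⟨ cong (λ x → _+_φ x (- + F₂)) (identity (+ F₂) (+ F₁)) ⟩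
  _+_φ (+ F₂ ℤ.+ + F₁) (- + F₂)          ≡⟨ cong (λ x → _+_φ x (- + F₂)) (ℤ.pos-+ F₂ F₁) ⟨
  _+_φ (+ (F₂ + F₁)) (- + F₂)            ∎
  where
  open ≡-Reasoning
  F₁ = fib (suc (s * 2))
  F₂ = fib (suc (suc (s * 2)))
  identity : ∀ x y → y ℤ.- - x ≡ x ℤ.+ y
  identity = solve-∀
φ^-odd s = begin
  φ⁻¹ ⊗ φ^- (s * 2)                      ≡⟨ cong (φ⁻¹ ⊗_) (φ^-even s) ⟩
  φ⁻¹ ⊗ _+_φ (+ F₁) (- + F₀)             ≡⟨ φ⁻¹-⊗ (+ F₁) (- + F₀) ⟩
  _+_φ (- + F₀ ℤ.- + F₁) (+ F₁)          ≡⟨ cong (λ x → _+_φ x (+ F₁)) (identity (+ F₁) (+ F₀)) ⟩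
  _+_φ (- (+ F₁ ℤ.+ + F₀)) (+ F₁)        ≡⟨ cong (λ x → _+_φ (- x) (+ F₁)) (ℤ.pos-+ F₁ F₀) ⟨
  _+_φ (- + (F₁ + F₀)) (+ F₁)            ∎
  where
  open ≡-Reasoning
  F₀ = fib (s * 2)
  F₁ = fib (suc (s * 2))
  identity : ∀ x y → - y ℤ.- x ≡ - (x ℤ.+ y)
  identity = solve-∀

norm-φ^-even : ∀ s → norm (φ^- (s * 2)) ≡ 1ℤ
norm-φ^-odd  : ∀ s → norm (φ^- (suc (s * 2))) ≡ -1ℤ
norm-φ^-even zero    = refl
norm-φ^-even (suc s) = trans (norm-⊗ φ⁻¹ (φ^- (suc (s * 2)))) (cong (-1ℤ ℤ.*_) (norm-φ^-odd s))
norm-φ^-odd  s       = trans (norm-⊗ φ⁻¹ (φ^- (s * 2))) (cong (-1ℤ ℤ.*_) (norm-φ^-even s))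

φ⊗ι-⊖ι : ∀ x k → φ ⊗ ι x ⊖ ι k ≡ _+_φ (- k) x
φ⊗ι-⊖ι x k = cong₂ _+_φ (re-identity x k) (im-identity x)
  where
  re-identity : ∀ x k → 0ℤ ℤ.* x ℤ.+ 1ℤ ℤ.* 0ℤ ℤ.+ - k ≡ - k
  re-identity = solve-∀
  im-identity : ∀ x → 0ℤ ℤ.* 0ℤ ℤ.+ 1ℤ ℤ.* x ℤ.+ 1ℤ ℤ.* 0ℤ ℤ.+ 0ℤ ≡ x
  im-identity = solve-∀

ι-⊖φ⊗ι : ∀ k x → ι k ⊖ φ ⊗ ι x ≡ _+_φ k (- x)
ι-⊖φ⊗ι k x = cong₂ _+_φ (re-identity k x) (im-identity x)
  where
  re-identity : ∀ k x → k ℤ.+ - (0ℤ ℤ.* x ℤ.+ 1ℤ ℤ.* 0ℤ) ≡ k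
  re-identity = solve-∀
  im-identity : ∀ x → 0ℤ ℤ.+ - (0ℤ ℤ.* 0ℤ ℤ.+ 1ℤ ℤ.* x ℤ.+ 1ℤ ℤ.* 0ℤ) ≡ - x
  im-identity = solve-∀

pos-+-* : ∀ p q r s → + (p * q + r * s) ≡ + p ℤ.* + q ℤ.+ + r ℤ.* + s
pos-+-* p q r s = trans (ℤ.pos-+ (p * q) (r * s)) (cong₂ ℤ._+_ (ℤ.pos-* p q) (ℤ.pos-* r s))

norm-φ⊗ιₙ-⊖ιₙ : ∀ b a → norm (φ ⊗ ιₙ b ⊖ ιₙ a) ≡ + (a * a) ℤ.- + (b * b + a * b)
norm-φ⊗ιₙ-⊖ιₙ b a = begin
  norm (φ ⊗ ιₙ b ⊖ ιₙ a)                                 ≡⟨ cong norm (φ⊗ι-⊖ι (+ b) (+ a)) ⟩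
  norm (_+_φ (- + a) (+ b))                              ≡⟨ identity (+ a) (+ b) ⟩
  + a ℤ.* + a ℤ.- (+ b ℤ.* + b ℤ.+ + a ℤ.* + b)          ≡⟨ cong₂ ℤ._-_ (ℤ.pos-* a a) (pos-+-* b b a b) ⟨
  + (a * a) ℤ.- + (b * b + a * b)                        ∎
  where
  open ≡-Reasoning
  identity : ∀ a b → - a ℤ.* - a ℤ.+ - a ℤ.* b ℤ.- b ℤ.* b ≡ a ℤ.* a ℤ.- (b ℤ.* b ℤ.+ a ℤ.* b)
  identity = solve-∀

trace-φ⊗ιₙ-⊖ιₙ : ∀ n m → trace (φ ⊗ ιₙ n ⊖ ιₙ m) ≡ + n ℤ.- + (2 * m)
trace-φ⊗ιₙ-⊖ιₙ n m = begin
  trace (φ ⊗ ιₙ n ⊖ ιₙ m)        ≡⟨ cong trace (φ⊗ι-⊖ι (+ n) (+ m)) ⟩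
  + 2 ℤ.* - + m ℤ.+ + n          ≡⟨ identity (+ n) (+ m) ⟩
  + n ℤ.- + 2 ℤ.* + m            ≡⟨ cong (λ x → + n ℤ.- x) (ℤ.pos-* 2 m) ⟨
  + n ℤ.- + (2 * m)              ∎
  where
  open ≡-Reasoning
  identity : ∀ n m → + 2 ℤ.* - m ℤ.+ n ≡ n ℤ.- + 2 ℤ.* m
  identity = solve-∀

trace-ιₙ-⊖φ⊗ιₙ : ∀ m n → trace (ιₙ m ⊖ φ ⊗ ιₙ n) ≡ + (2 * m) ℤ.- + n
trace-ιₙ-⊖φ⊗ιₙ m n = begin
  trace (ιₙ m ⊖ φ ⊗ ιₙ n)        ≡⟨ cong trace (ι-⊖φ⊗ι (+ m) (+ n)) ⟩
  + 2 ℤ.* + m ℤ.+ - + n          ≡⟨ cong (ℤ._- + n) (ℤ.pos-* 2 m) ⟨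
  + (2 * m) ℤ.- + n              ∎
  where open ≡-Reasoning

φ^-even⊗[φb-a] : ∀ s a b → let t = suc s * 2 in
  φ^- t ⊗ (φ ⊗ ιₙ b ⊖ ιₙ a) ≡ φ ⊗ ιₙ (a * fib t + b * fib (t ∸ 1)) ⊖ ιₙ (a * fib (suc t) + b * fib t)
φ^-even⊗[φb-a] s a b = begin
  φ^- t ⊗ (φ ⊗ ιₙ b ⊖ ιₙ a)                        ≡⟨ cong₂ _⊗_ (φ^-even (suc s)) (φ⊗ι-⊖ι (+ b) (+ a)) ⟩
  _+_φ (+ (F + G)) (- + F) ⊗ _+_φ (- + a) (+ b)    ≡⟨ cong₂ _+_φ re≡ im≡ ⟩
  _+_φ (- + (a * (F + G) + b * F)) (+ (a * F + b * G)) ≡⟨ φ⊗ι-⊖ι (+ (a * F + b * G)) (+ (a * (F + G) + b * F)) ⟨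
  φ ⊗ ιₙ (a * F + b * G) ⊖ ιₙ (a * (F + G) + b * F) ∎
  where
  open ≡-Reasoning
  t = suc s * 2
  F = fib t
  G = fib (t ∸ 1)
  re-identity : ∀ F₊ F a b → F₊ ℤ.* - a ℤ.+ - F ℤ.* b ≡ - (a ℤ.* F₊ ℤ.+ b ℤ.* F)
  re-identity = solve-∀
  im-identity : ∀ F G a b → (F ℤ.+ G) ℤ.* b ℤ.+ - F ℤ.* - a ℤ.+ - F ℤ.* b ≡ a ℤ.* F ℤ.+ b ℤ.* G
  im-identity = solve-∀
  re≡ : + (F + G) ℤ.* - + a ℤ.+ - + F ℤ.* + b ≡ - + (a * (F + G) + b * F)
  re≡ = trans (re-identity (+ (F + G)) (+ F) (+ a) (+ b)) (cong -_ (sym (pos-+-* a (F + G) b F)))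
  im≡ : + (F + G) ℤ.* + b ℤ.+ - + F ℤ.* - + a ℤ.+ - + F ℤ.* + b ≡ + (a * F + b * G)
  im≡ = begin
    + (F + G) ℤ.* + b ℤ.+ - + F ℤ.* - + a ℤ.+ - + F ℤ.* + b
      ≡⟨ cong (λ x → x ℤ.* + b ℤ.+ - + F ℤ.* - + a ℤ.+ - + F ℤ.* + b) (ℤ.pos-+ F G) ⟩
    (+ F ℤ.+ + G) ℤ.* + b ℤ.+ - + F ℤ.* - + a ℤ.+ - + F ℤ.* + b
      ≡⟨ im-identity (+ F) (+ G) (+ a) (+ b) ⟩
    + a ℤ.* + F ℤ.+ + b ℤ.* + G
      ≡⟨ pos-+-* a F b G ⟨
    + (a * F + b * G) ∎

φ^-odd⊗[φb-a] : ∀ s a b → let t = suc (suc s * 2) in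
  φ^- t ⊗ (φ ⊗ ιₙ b ⊖ ιₙ a) ≡ ιₙ (a * fib (suc t) + b * fib t) ⊖ φ ⊗ ιₙ (a * fib t + b * fib (t ∸ 1))
φ^-odd⊗[φb-a] s a b = begin
  φ^- t ⊗ (φ ⊗ ιₙ b ⊖ ιₙ a)                        ≡⟨ cong₂ _⊗_ (φ^-odd (suc s)) (φ⊗ι-⊖ι (+ b) (+ a)) ⟩
  _+_φ (- + (F + G)) (+ F) ⊗ _+_φ (- + a) (+ b)    ≡⟨ cong₂ _+_φ re≡ im≡ ⟩
  _+_φ (+ (a * (F + G) + b * F)) (- + (a * F + b * G)) ≡⟨ ι-⊖φ⊗ι (+ (a * (F + G) + b * F)) (+ (a * F + b * G)) ⟨
  ιₙ (a * (F + G) + b * F) ⊖ φ ⊗ ιₙ (a * F + b * G) ∎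
  where
  open ≡-Reasoning
  t = suc (suc s * 2)
  F = fib t
  G = fib (t ∸ 1)
  re-identity : ∀ F₊ F a b → - F₊ ℤ.* - a ℤ.+ F ℤ.* b ≡ a ℤ.* F₊ ℤ.+ b ℤ.* F
  re-identity = solve-∀
  im-identity : ∀ F G a b → - (F ℤ.+ G) ℤ.* b ℤ.+ F ℤ.* - a ℤ.+ F ℤ.* b ≡ - (a ℤ.* F ℤ.+ b ℤ.* G)
  im-identity = solve-∀
  re≡ : - + (F + G) ℤ.* - + a ℤ.+ + F ℤ.* + b ≡ + (a * (F + G) + b * F)
  re≡ = trans (re-identity (+ (F + G)) (+ F) (+ a) (+ b)) (sym (pos-+-* a (F + G) b F))
  im≡ : - + (F + G) ℤ.* + b ℤ.+ + F ℤ.* - + a ℤ.+ + F ℤ.* + b ≡ - + (a * F + b * G)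
  im≡ = begin
    - + (F + G) ℤ.* + b ℤ.+ + F ℤ.* - + a ℤ.+ + F ℤ.* + b
      ≡⟨ cong (λ x → - x ℤ.* + b ℤ.+ + F ℤ.* - + a ℤ.+ + F ℤ.* + b) (ℤ.pos-+ F G) ⟩
    - (+ F ℤ.+ + G) ℤ.* + b ℤ.+ + F ℤ.* - + a ℤ.+ + F ℤ.* + b
      ≡⟨ im-identity (+ F) (+ G) (+ a) (+ b) ⟩
    - (+ a ℤ.* + F ℤ.+ + b ℤ.* + G)
      ≡⟨ cong -_ (pos-+-* a F b G) ⟨
    - + (a * F + b * G) ∎

1≤fib[1+n] : ∀ n → 1 ≤ fib (suc n)
1≤fib[1+n] zero    = ℕ.≤-refl
1≤fib[1+n] (suc n) = ℕ.≤-trans (1≤fib[1+n] n) (ℕ.m≤m+n (fib (suc n)) (fib n))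

b²+ab+n<2m : ∀ {a b G H} → 1 ≤ a → 1 ≤ G → b ≤ G + H →
  (b * b + a * b) + (a * (G + H) + b * G) < 2 * (a * (G + H + G) + b * (G + H))
b²+ab+n<2m {a} {b} {G} {H} 1≤a 1≤G b≤F = begin-strict
  (b * b + a * b) + n                          ≡⟨ cong (_+ n) (identity a b) ⟩
  (a + b) * b + n                              ≤⟨ ℕ.+-monoˡ-≤ n (ℕ.*-monoʳ-≤ (a + b) b≤F) ⟩
  (a + b) * (G + H) + n                        <⟨ ℕ.m<m+n _ (ℕ.≤-trans (ℕ.*-mono-≤ 1≤a 1≤G) (ℕ.m≤m+n (a * G) _)) ⟩
  (a + b) * (G + H) + n + (a * G + (a * G + b * H)) ≡⟨ doubling a b G H ⟩
  2 * (a * (G + H + G) + b * (G + H))          ∎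
  where
  open ℕ.≤-Reasoning
  n = a * (G + H) + b * G
  identity : ∀ a b → b * b + a * b ≡ (a + b) * b
  identity = NS.solve-∀
  doubling : ∀ a b G H → (a + b) * (G + H) + (a * (G + H) + b * G) + (a * G + (a * G + b * H))
                         ≡ 2 * (a * (G + H + G) + b * (G + H))
  doubling = NS.solve-∀

diff-mono-≤ : ∀ {x y z w} → x + w ≤ z + y → + x ℤ.- + y ℤ.≤ + z ℤ.- + w
diff-mono-≤ {x} {y} {z} {w} x+w≤z+y =
  subst₂ ℤ._≤_ (cancel-w (+ x) (+ y) (+ w)) (cancel-y (+ z) (+ y) (+ w))
    (ℤ.+-monoˡ-≤ (- (+ y ℤ.+ + w)) (subst₂ ℤ._≤_ (ℤ.pos-+ x w) (ℤ.pos-+ z y) (+≤+ x+w≤z+y)))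
  where
  cancel-w : ∀ x y w → x ℤ.+ w ℤ.- (y ℤ.+ w) ≡ x ℤ.- y
  cancel-w = solve-∀
  cancel-y : ∀ z y w → z ℤ.+ y ℤ.- (y ℤ.+ w) ≡ z ℤ.- w
  cancel-y = solve-∀

+[1+x]-+y : ∀ x y → + suc x ℤ.- + y ≡ + x ℤ.- + y ℤ.+ 1ℤ
+[1+x]-+y x y = trans (cong (ℤ._- + y) (ℤ.pos-+ 1 x)) (identity (+ x) (+ y))
  where
  identity : ∀ x y → 1ℤ ℤ.+ x ℤ.- y ≡ x ℤ.- y ℤ.+ 1ℤ
  identity = solve-∀

diff-mono-< : ∀ {x y z w} → x + w < z + y → + x ℤ.- + y ℤ.< + z ℤ.- + w
diff-mono-< {x} {y} {z} {w} x+w<z+y =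
  ℤ.suc[i]≤j⇒i<j (subst (ℤ._≤ + z ℤ.- + w) (trans (+[1+x]-+y x y) (ℤ.+-comm (+ x ℤ.- + y) 1ℤ))
                                           (diff-mono-≤ {suc x} {y} {z} {w} x+w<z+y))

a²≤b²+ab : ∀ {a b} → a ≤ b → a * a ≤ b * b + a * b
a²≤b²+ab {a} {b} a≤b = ℕ.≤-trans (ℕ.*-monoʳ-≤ a a≤b) (ℕ.m≤n+m (a * b) (b * b))

φ^-even⊗[φb-a]≡δ : ∀ {t a b k} s → t ≡ s * 2 → 2 ≤ t → 1 ≤ a → a ≤ b → b ≤ fib t →
  IsFloor k (φ ⊗ ιₙ (a * fib t + b * fib (t ∸ 1))) →
  φ^- t ⊗ (φ ⊗ ιₙ b ⊖ ιₙ a) ≡ φ ⊗ ιₙ (a * fib t + b * fib (t ∸ 1)) ⊖ ι k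
φ^-even⊗[φb-a]≡δ zero refl ()
φ^-even⊗[φb-a]≡δ {a = a} {b} {k} (suc s) refl _ 1≤a a≤b b≤F ⌊φn⌋≡k =
  trans (φ^-even⊗[φb-a] s a b) (cong (λ j → φ ⊗ ιₙ n ⊖ ι j) (IsFloor-unique {+ m} {k} {φ ⊗ ιₙ n} ⌊φn⌋≡m ⌊φn⌋≡k))
  where
  t = suc s * 2
  n = a * fib t + b * fib (t ∸ 1)
  m = a * fib (suc t) + b * fib t
  d = φ ⊗ ιₙ n ⊖ ιₙ m
  norm-d : norm d ≡ + (a * a) ℤ.- + (b * b + a * b)
  norm-d = begin
    norm d                                           ≡⟨ cong norm (φ^-even⊗[φb-a] s a b) ⟨
    norm (φ^- t ⊗ (φ ⊗ ιₙ b ⊖ ιₙ a))                 ≡⟨ norm-⊗ (φ^- t) (φ ⊗ ιₙ b ⊖ ιₙ a) ⟩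
    norm (φ^- t) ℤ.* norm (φ ⊗ ιₙ b ⊖ ιₙ a)          ≡⟨ cong₂ ℤ._*_ (norm-φ^-even (suc s)) (norm-φ⊗ιₙ-⊖ιₙ b a) ⟩
    1ℤ ℤ.* (+ (a * a) ℤ.- + (b * b + a * b))         ≡⟨ ℤ.*-identityˡ _ ⟩
    + (a * a) ℤ.- + (b * b + a * b)                  ∎
    where open ≡-Reasoning
  0<n : 0 < n
  0<n = ℕ.≤-trans (ℕ.*-mono-≤ 1≤a (1≤fib[1+n] (suc (s * 2)))) (ℕ.m≤m+n _ _)
  n+[b²+ab]≤a²+2m : n + (b * b + a * b) ≤ a * a + 2 * m
  n+[b²+ab]≤a²+2m = begin
    n + (b * b + a * b)   ≡⟨ ℕ.+-comm n _ ⟩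
    (b * b + a * b) + n   <⟨ b²+ab+n<2m 1≤a (1≤fib[1+n] (s * 2)) b≤F ⟩
    2 * m                 ≤⟨ ℕ.m≤n+m _ (a * a) ⟩
    a * a + 2 * m         ∎
    where open ℕ.≤-Reasoning
  0<im : 0ℤ ℤ.< im d
  0<im = subst (0ℤ ℤ.<_) (sym (cong im (φ⊗ι-⊖ι (+ n) (+ m)))) (+<+ 0<n)
  trace≤norm : trace d ℤ.≤ norm d
  trace≤norm = subst₂ ℤ._≤_ (sym (trace-φ⊗ιₙ-⊖ιₙ n m)) (sym norm-d)
    (diff-mono-≤ {n} {2 * m} {a * a} {b * b + a * b} n+[b²+ab]≤a²+2m)
  norm≤0 : norm d ℤ.≤ 0ℤ
  norm≤0 = subst (ℤ._≤ 0ℤ) (sym norm-d) (ℤ.i≤j⇒i-j≤0 (+≤+ (a²≤b²+ab a≤b)))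
  ⌊φn⌋≡m : IsFloor (+ m) (φ ⊗ ιₙ n)
  ⌊φn⌋≡m = InUnitInterval⇒IsFloor {+ m} {φ ⊗ ιₙ n} (0<im⇒InUnitInterval d 0<im trace≤norm norm≤0)

φ^-odd⊗[φb-a]≡Δ : ∀ {t a b k} s → t ≡ suc (s * 2) → 2 ≤ t → 1 ≤ a → a ≤ b → b ≤ fib t →
  IsCeil k (φ ⊗ ιₙ (a * fib t + b * fib (t ∸ 1))) →
  φ^- t ⊗ (φ ⊗ ιₙ b ⊖ ιₙ a) ≡ ι k ⊖ φ ⊗ ιₙ (a * fib t + b * fib (t ∸ 1))
φ^-odd⊗[φb-a]≡Δ zero refl (ℕ.s≤s ())
φ^-odd⊗[φb-a]≡Δ {a = a} {b} {k} (suc s) refl _ 1≤a a≤b b≤F ⌈φn⌉≡k =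
  trans (φ^-odd⊗[φb-a] s a b) (cong (λ j → ι j ⊖ φ ⊗ ιₙ n) (IsCeil-unique {+ m} {k} {φ ⊗ ιₙ n} ⌈φn⌉≡m ⌈φn⌉≡k))
  where
  t = suc (suc s * 2)
  n = a * fib t + b * fib (t ∸ 1)
  m = a * fib (suc t) + b * fib t
  d = ιₙ m ⊖ φ ⊗ ιₙ n
  norm-d : norm d ≡ + (b * b + a * b) ℤ.- + (a * a)
  norm-d = begin
    norm d                                           ≡⟨ cong norm (φ^-odd⊗[φb-a] s a b) ⟨
    norm (φ^- t ⊗ (φ ⊗ ιₙ b ⊖ ιₙ a))                 ≡⟨ norm-⊗ (φ^- t) (φ ⊗ ιₙ b ⊖ ιₙ a) ⟩
    norm (φ^- t) ℤ.* norm (φ ⊗ ιₙ b ⊖ ιₙ a)          ≡⟨ cong₂ ℤ._*_ (norm-φ^-odd (suc s)) (norm-φ⊗ιₙ-⊖ιₙ b a) ⟩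
    -1ℤ ℤ.* (+ (a * a) ℤ.- + (b * b + a * b))        ≡⟨ identity (+ (a * a)) (+ (b * b + a * b)) ⟩
    + (b * b + a * b) ℤ.- + (a * a)                  ∎
    where
    open ≡-Reasoning
    identity : ∀ x y → -1ℤ ℤ.* (x ℤ.- y) ≡ y ℤ.- x
    identity = solve-∀
  0<n : 0 < n
  0<n = ℕ.≤-trans (ℕ.*-mono-≤ 1≤a (1≤fib[1+n] (suc s * 2))) (ℕ.m≤m+n _ _)
  1+[b²+ab]+n<2m+a² : suc (b * b + a * b) + n < 2 * m + a * a
  1+[b²+ab]+n<2m+a² = begin-strict
    suc (b * b + a * b + n)   ≡⟨ ℕ.+-comm 1 (b * b + a * b + n) ⟩
    (b * b + a * b + n) + 1   <⟨ ℕ.+-mono-<-≤ (b²+ab+n<2m 1≤a (1≤fib[1+n] (suc (s * 2))) b≤F) (ℕ.*-mono-≤ 1≤a 1≤a) ⟩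
    2 * m + a * a             ∎
    where open ℕ.≤-Reasoning
  im<0 : im d ℤ.< 0ℤ
  im<0 = subst (ℤ._< 0ℤ) (sym (cong im (ι-⊖φ⊗ι (+ m) (+ n)))) (ℤ.neg-mono-< (+<+ 0<n))
  0≤norm : 0ℤ ℤ.≤ norm d
  0≤norm = subst (0ℤ ℤ.≤_) (sym norm-d) (ℤ.i≤j⇒0≤j-i (+≤+ (a²≤b²+ab a≤b)))
  norm+1<trace : norm d ℤ.+ 1ℤ ℤ.< trace d
  norm+1<trace = subst₂ ℤ._<_
    (trans (+[1+x]-+y (b * b + a * b) (a * a)) (cong (ℤ._+ 1ℤ) (sym norm-d)))
    (sym (trace-ιₙ-⊖φ⊗ιₙ m n))
    (diff-mono-< {suc (b * b + a * b)} {a * a} {2 * m} {n} 1+[b²+ab]+n<2m+a²)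
  ⌈φn⌉≡m : IsCeil (+ m) (φ ⊗ ιₙ n)
  ⌈φn⌉≡m = InUnitInterval⇒IsCeil {+ m} {φ ⊗ ιₙ n} (im<0⇒InUnitInterval d im<0 0≤norm norm+1<trace)

%2≡0⇒≡[/2]*2 : ∀ t → t % 2 ≡ 0 → t ≡ t / 2 * 2
%2≡0⇒≡[/2]*2 t t%2≡0 = trans (m≡m%n+[m/n]*n t 2) (cong (_+ t / 2 * 2) t%2≡0)

%2≡1⇒≡1+[/2]*2 : ∀ t → t % 2 ≡ 1 → t ≡ suc (t / 2 * 2)
%2≡1⇒≡1+[/2]*2 t t%2≡1 = trans (m≡m%n+[m/n]*n t 2) (cong (_+ t / 2 * 2) t%2≡1)

lemma12 : (n a b t : ℕ) → 2 ≤ n → 2 ≤ t → n ≡ a * fib t + b * fib (t ∸ 1) →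
          1 ≤ a → a ≤ b → b ≤ fib t →
          (t % 2 ≡ 0 → (k : ℤ) → IsFloor k (φ ⊗ ιₙ n) →
            (φ^- t) ⊗ (φ ⊗ ιₙ b ⊖ ιₙ a) ≡ φ ⊗ ιₙ n ⊖ ι k)
          × (t % 2 ≡ 1 → (k : ℤ) → IsCeil k (φ ⊗ ιₙ n) →
            (φ^- t) ⊗ (φ ⊗ ιₙ b ⊖ ιₙ a) ≡ ι k ⊖ φ ⊗ ιₙ n)
lemma12 n a b t _ 2≤t refl 1≤a a≤b b≤F =
    (λ t%2≡0 k → φ^-even⊗[φb-a]≡δ {k = k} (t / 2) (%2≡0⇒≡[/2]*2 t t%2≡0) 2≤t 1≤a a≤b b≤F)
  , (λ t%2≡1 k → φ^-odd⊗[φb-a]≡Δ {k = k} (t / 2) (%2≡1⇒≡1+[/2]*2 t t%2≡1) 2≤t 1≤a a≤b b≤F)
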